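{- Let $(n,e)$ be valid and $c=c(n,e)$. If $cn\in\mathbb{N}$, then $k(n,e)=k(2e/n^2)=:k$ and $\bm a^*(n,e)=(cn,\dots,cn,n-(k-1)cn)$ (with $k-1$ entries equal to $cn$).
   Context: $(n,e)$ with $n,e\in\mathbb{N}$ is valid if $\lfloor n^2/4\rfloor<e\le\binom n2$. $t_s(n)$ is the number of edges of the Turán graph $T_s(n)$; $k(n,e):=\min\{s\in\mathbb{N}:e\le t_s(n)\}$. For $\lambda\in[0,1)$, $k(\lambda):=\min\{k\in\mathbb{N}:\lambda\le1-1/k\}$; $c(0):=1$ and for $\lambda\in(0,1)$, $c(\lambda):=\frac1{k(\lambda)}\left(1+\sqrt{1-\frac{k(\lambda)}{k(\lambda)-1}\lambda}\right)$. Set $c(n,e):=c(2e/n^2)$. With $k=k(n,e)$, the vector $\bm a^*(n,e)=(a_1^*,\dots,a_k^*)$ is defined by $a_k^*:=\min\{a\in\mathbb{N}:a(n-a)+t_{k-1}(n-a)\ge e\}$ and $a_1^*+\dots+a_{k-1}^*=n-a_k^*$, $a_1^*\ge\dots\ge a_{k-1}^*\ge a_1^*-1$. -}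

module Defs where

open import Data.Nat using (ℕ; zero; suc; _+_; _*_; _∸_; _≤_; _<_; _≥_)
open import Data.Nat.DivMod using (_/_; _%_)
open import Data.Nat.Combinatorics using (_C_)
open import Data.Fin using (Fin; toℕ)
open import Data.Vec.Functional using (Vector; foldr)
open import Data.Product using (_×_)
open import Relation.Binary.PropositionalEquality using (_≡_)

IsLeast : (ℕ → Set) → ℕ → Set
IsLeast P x = P x × (∀ y → P y → x ≤ y)

Valid : ℕ → ℕ → Set
Valid n e = ((n * n) / 4 < e) × (e ≤ n C 2)

-- t_s(n): number of edges of the Turán graph T_s(n) (complete s-partite
-- graph on n vertices with part sizes as equal as possible: r = n mod s parts
-- of size q+1 and s-r parts of size q, where q = n div s).
turan : ℕ → ℕ → ℕ
turan zero    n = 0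
turan (suc s) n =
  (n C 2) ∸ ((n % suc s) * (suc (n / suc s) C 2))
          ∸ ((suc s ∸ n % suc s) * ((n / suc s) C 2))

KnePred : ℕ → ℕ → ℕ → Set
KnePred n e s = e ≤ turan s n

-- k(λ) with λ = 2e/n² : min { k ≥ 1 : 2e/n² ≤ 1 - 1/k },
-- i.e. (cleared denominators) 2e·k ≤ (k-1)·n²
KλPred : ℕ → ℕ → ℕ → Set
KλPred n e k = (1 ≤ k) × (2 * e * k ≤ (k ∸ 1) * (n * n))

-- "c(n,e)·n = m" where k = k(2e/n²):
--   c·n = (n/k)(1 + √(1 - (k/(k-1))·2e/n²)) = m
--   ⇔ √(1 - 2ke/((k-1)n²)) = (km - n)/n
--   ⇔ km ≥ n  and  (k-1)(km - n)² = (k-1)n² - 2ke.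
CnEq : ℕ → ℕ → ℕ → ℕ → Set
CnEq n e k m =
  (n ≤ k * m) ×
  ((k ∸ 1) * ((k * m ∸ n) * (k * m ∸ n)) + 2 * k * e ≡ (k ∸ 1) * (n * n))

AkPred : ℕ → ℕ → ℕ → ℕ → Set
AkPred n e k a = e ≤ a * (n ∸ a) + turan (k ∸ 1) (n ∸ a)

vsum : ∀ {j} → Vector ℕ j → ℕ
vsum = foldr _+_ 0

Balanced : ∀ {j} → Vector ℕ j → ℕ → Set
Balanced {j} v N =
  (vsum v ≡ N) ×
  (∀ (i i' : Fin j) → toℕ i ≤ toℕ i' → v i' ≤ v i) ×
  (∀ (i i' : Fin j) → v i ≤ suc (v i'))

module Submission where

-- Write k = j + 2 and K = k - 1 = j + 1.  The defining equation of m (CnEq), together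
-- with the minimality of k = k(2e/n²), forces the "extremal configuration"
--   n = K·m + a,  a ≤ m,  2e = K·m·(j·m + 2a),
-- i.e. e is the edge count of the complete k-partite graph with K parts of size m and one
-- part of size a.  Everything then follows from two facts about Turán numbers:
--   * upper bound  2·t_s(n)·s ≤ (s-1)·n²  (Turán density), and
--   * lower bound  2·t_{c+1}(cm+a) ≥ (cm+a)² - (c·m² + a²)  (the balanced partition has the
--     least sum of squared part sizes),
-- both derived from the exact formula 2·t_s(n) = n² - Σ(part sizes)².  The upper bound gives
-- minimality of k(n,e) and of a_k*; the lower bound shows that k and a are admissible.
-- Finally a balanced vector whose sum is K·m has all entries equal to m.

open import Defs
open import Data.Nat using (ℕ; zero; suc; _+_; _*_; _∸_; _≤_; _<_; z≤n; s≤s; s≤s⁻¹; _≤?_)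
open import Data.Nat.Properties
open import Data.Nat.DivMod using (_/_; _%_; m≡m%n+[m/n]*n; m%n<n)
open import Data.Nat.Combinatorics using (_C_; nCk+nC[k+1]≡[n+1]C[k+1]; nC1≡n)
open import Data.Nat.Tactic.RingSolver using (solve-∀)
open import Data.Fin as F using (Fin)
open import Data.Vec.Functional using (Vector; tail)
open import Data.Product using (Σ; _×_; _,_; proj₁; proj₂)
open import Data.Empty using (⊥-elim)
open import Function using (_∘_)
open import Relation.Nullary using (¬_; yes; no)
open import Relation.Binary.Definitions using (tri<; tri≈; tri>)
open import Relation.Binary.PropositionalEquality
  using (_≡_; refl; sym; trans; cong; cong₂; subst; module ≡-Reasoning)

twiceChoose2 : ∀ n → 2 * (n C 2) + n ≡ n * n
twiceChoose2 zero = refl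
twiceChoose2 (suc n) rewrite sym (nCk+nC[k+1]≡[n+1]C[k+1] n 1) | nC1≡n n =
  trans (regroup n (n C 2)) (trans (cong (_+ (n + suc n)) (twiceChoose2 n)) (square-suc n))
  where
  regroup : ∀ n c → 2 * (n + c) + suc n ≡ (2 * c + n) + (n + suc n)
  regroup = solve-∀
  square-suc : ∀ n → n * n + (n + suc n) ≡ suc n * suc n
  square-suc = solve-∀

-- Sum of squared part sizes of the Turán partition with s parts: r parts of size q+1 and
-- s-r parts of size q (valid when r ≤ s).
partSquares : ℕ → ℕ → ℕ → ℕ
partSquares s q r = s * q * q + 2 * q * r + r

partPairs : ℕ → ℕ → ℕ → ℕ
partPairs s q r = r * (suc q C 2) + (s ∸ r) * (q C 2)

twicePartPairs : ∀ s q r → r ≤ s → 2 * partPairs s q r + (r + q * s) ≡ partSquares s q r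
twicePartPairs s q r r≤s with s ∸ r | m+[n∸m]≡n r≤s
... | t | refl = begin
    2 * (r * (suc q C 2) + t * (q C 2)) + (r + q * (r + t))
      ≡⟨ expand r t q (suc q C 2) (q C 2) ⟩
    r * (2 * (suc q C 2) + suc q) + t * (2 * (q C 2) + q)
      ≡⟨ cong₂ (λ x y → r * x + t * y) (twiceChoose2 (suc q)) (twiceChoose2 q) ⟩
    r * (suc q * suc q) + t * (q * q)
      ≡⟨ collect r t q ⟩
    (r + t) * q * q + 2 * q * r + r ∎
  where
  open ≡-Reasoning
  expand : ∀ r t q c₁ c₀ → 2 * (r * c₁ + t * c₀) + (r + q * (r + t))
                          ≡ r * (2 * c₁ + suc q) + t * (2 * c₀ + q)
  expand = solve-∀
  collect : ∀ r t q → r * (suc q * suc q) + t * (q * q) ≡ (r + t) * q * q + 2 * q * r + r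
  collect = solve-∀

twiceTuran : ∀ s' n → 2 * turan (suc s') n ≡ n * n ∸ partSquares (suc s') (n / suc s') (n % suc s')
twiceTuran s' n = begin
    2 * turan s n                        ≡⟨ cong (2 *_) (∸-+-assoc (n C 2) (r * (suc q C 2)) ((s ∸ r) * (q C 2))) ⟩
    2 * ((n C 2) ∸ P)                    ≡⟨ *-distribˡ-∸ 2 (n C 2) P ⟩
    2 * (n C 2) ∸ 2 * P                  ≡⟨ sym ([m+n]∸[m+o]≡n∸o n (2 * (n C 2)) (2 * P)) ⟩
    (n + 2 * (n C 2)) ∸ (n + 2 * P)      ≡⟨ cong₂ _∸_ (trans (+-comm n _) (twiceChoose2 n))
                                                      (trans (+-comm n _) squares) ⟩
    n * n ∸ partSquares s q r ∎
  where
  open ≡-Reasoning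
  s = suc s'
  q = n / s
  r = n % s
  P = partPairs s q r
  squares : 2 * P + n ≡ partSquares s q r
  squares = trans (cong (2 * P +_) (m≡m%n+[m/n]*n n s)) (twicePartPairs s q r (<⇒≤ (m%n<n n s)))

-- Cauchy–Schwarz for the Turán partition: n² ≤ s·Σ(part sizes)² (the defect is r(s-r)).
square≤partSquares : ∀ s q r → r ≤ s → (r + q * s) * (r + q * s) ≤ partSquares s q r * s
square≤partSquares s q r r≤s with s ∸ r | m+[n∸m]≡n r≤s
... | t | refl = subst ((r + q * (r + t)) * (r + q * (r + t)) ≤_) (sym (defect q r t)) (m≤m+n _ (r * t))
  where
  defect : ∀ q r t → ((r + t) * q * q + 2 * q * r + r) * (r + t)
                     ≡ (r + q * (r + t)) * (r + q * (r + t)) + r * t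
  defect = solve-∀

-- Turán's bound t_s(n) ≤ (1 - 1/s)·n²/2, from the exact formula and Cauchy–Schwarz.
turan-upper : ∀ s' n → 2 * turan (suc s') n * suc s' ≤ s' * (n * n)
turan-upper s' n = begin
    2 * turan s n * s        ≡⟨ cong (_* s) (twiceTuran s' n) ⟩
    (n * n ∸ Q) * s          ≡⟨ *-distribʳ-∸ s (n * n) Q ⟩
    n * n * s ∸ Q * s        ≤⟨ m≤n+o⇒m∸n≤o (n * n * s) (Q * s) split ⟩
    s' * (n * n) ∎
  where
  open ≤-Reasoning
  s = suc s'
  Q = partSquares s (n / s) (n % s)
  n²≤ : n * n ≤ Q * s
  n²≤ = subst (λ x → x * x ≤ Q * s) (sym (m≡m%n+[m/n]*n n s))
          (square≤partSquares s (n / s) (n % s) (<⇒≤ (m%n<n n s)))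
  times-suc : ∀ s' x → x * suc s' ≡ x + s' * x
  times-suc = solve-∀
  split : n * n * s ≤ Q * s + s' * (n * n)
  split = subst (_≤ Q * s + s' * (n * n)) (sym (times-suc s' (n * n))) (+-monoˡ-≤ (s' * (n * n)) n²≤)

-- (p - q)(p - q - 1) ≥ 0, i.e. a square is minimised at consecutive integers.
consecutive-square : ∀ p q → suc (2 * q) * p ≤ p * p + q * suc q
consecutive-square p q with p ≤? q
... | yes p≤q with q ∸ p | m+[n∸m]≡n p≤q
...   | u | refl = subst (suc (2 * (p + u)) * p ≤_) (gap p u) (m≤m+n _ (u * u + u))
  where
  gap : ∀ p u → suc (2 * (p + u)) * p + (u * u + u) ≡ p * p + (p + u) * suc (p + u)
  gap = solve-∀
consecutive-square p q | no p≰q with p ∸ suc q | m+[n∸m]≡n (≰⇒> p≰q)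
... | u | refl = subst (suc (2 * q) * (suc q + u) ≤_) (gap q u) (m≤m+n _ (u * u + u))
  where
  gap : ∀ q u → suc (2 * q) * (suc q + u) + (u * u + u) ≡ (suc q + u) * (suc q + u) + q * suc q
  gap = solve-∀

-- If c·m + a = q(c+1) + r, the Turán partition into c+1 parts has sum of squares at most
-- c·m² + a²; summing consecutive-square over the c+1 parts m, …, m, a.
partSquares-minimal : ∀ c m a q r → r ≤ suc c → c * m + a ≡ r + q * suc c →
                      partSquares (suc c) q r ≤ c * (m * m) + a * a
partSquares-minimal c m a q r r≤s n≡ = +-cancelʳ-≤ (s * (q * suc q)) _ _ (begin
    partSquares s q r + s * (q * suc q)             ≡⟨ sym (weigh s q r) ⟩
    suc (2 * q) * (r + q * s)                       ≡⟨ cong (suc (2 * q) *_) (sym n≡) ⟩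
    suc (2 * q) * (c * m + a)                       ≡⟨ distribute c m a q ⟩
    c * (suc (2 * q) * m) + suc (2 * q) * a         ≤⟨ +-mono-≤ (*-monoʳ-≤ c (consecutive-square m q))
                                                                 (consecutive-square a q) ⟩
    c * (m * m + q * suc q) + (a * a + q * suc q)   ≡⟨ collect c m a q ⟩
    c * (m * m) + a * a + s * (q * suc q) ∎)
  where
  open ≤-Reasoning
  s = suc c
  weigh : ∀ s q r → suc (2 * q) * (r + q * s) ≡ (s * q * q + 2 * q * r + r) + s * (q * suc q)
  weigh = solve-∀
  distribute : ∀ c m a q → suc (2 * q) * (c * m + a) ≡ c * (suc (2 * q) * m) + suc (2 * q) * a
  distribute = solve-∀
  collect : ∀ c m a q → c * (m * m + q * suc q) + (a * a + q * suc q)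
                        ≡ c * (m * m) + a * a + suc c * (q * suc q)
  collect = solve-∀

-- 2·t_{c+1}(cm + a) ≥ (cm + a)² - (c·m² + a²): the Turán graph has at least as many edges
-- as the complete (c+1)-partite graph with parts m, …, m, a.
turan-lower : ∀ c m a → (c * m + a) * (c * m + a) ∸ (c * (m * m) + a * a) ≤ 2 * turan (suc c) (c * m + a)
turan-lower c m a = subst (n * n ∸ (c * (m * m) + a * a) ≤_) (sym (twiceTuran c n))
  (∸-monoʳ-≤ (n * n) (partSquares-minimal c m a (n / suc c) (n % suc c)
                        (<⇒≤ (m%n<n n (suc c))) (m≡m%n+[m/n]*n n (suc c))))
  where n = c * m + a

turan-equipartite : ∀ j m → suc j * j * (m * m) ≤ 2 * turan (suc j) (suc j * m)
turan-equipartite j m = subst (λ x → x ≤ 2 * turan (suc j) (suc j * m)) count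
  (subst (λ x → x * x ∸ (j * (m * m) + m * m) ≤ 2 * turan (suc j) x) (+-comm (j * m) m)
         (turan-lower j m m))
  where
  square : ∀ j m → (suc j * m) * (suc j * m) ≡ suc j * j * (m * m) + (j * (m * m) + m * m)
  square = solve-∀
  count : (suc j * m) * (suc j * m) ∸ (j * (m * m) + m * m) ≡ suc j * j * (m * m)
  count = trans (cong (_∸ (j * (m * m) + m * m)) (square j m)) (m+n∸n≡m _ (j * (m * m) + m * m))

vsum-mono : ∀ {K} (u w : Vector ℕ K) → (∀ i → u i ≤ w i) → vsum u ≤ vsum w
vsum-mono {zero}  u w u≤w = z≤n
vsum-mono {suc K} u w u≤w = +-mono-≤ (u≤w F.zero) (vsum-mono (tail u) (tail w) (u≤w ∘ F.suc))

vsum-mono-< : ∀ {K} (u w : Vector ℕ K) → (∀ i → u i ≤ w i) → ∀ i → u i < w i → vsum u < vsum w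
vsum-mono-< {suc K} u w u≤w F.zero    u<w = +-mono-<-≤ u<w (vsum-mono (tail u) (tail w) (u≤w ∘ F.suc))
vsum-mono-< {suc K} u w u≤w (F.suc i) u<w =
  +-mono-≤-< (u≤w F.zero) (vsum-mono-< (tail u) (tail w) (u≤w ∘ F.suc) i u<w)

vsum-const : ∀ K m → vsum {K} (λ _ → m) ≡ K * m
vsum-const zero    m = refl
vsum-const (suc K) m = cong (m +_) (vsum-const K m)

balanced-constant : ∀ {K} (v : Vector ℕ K) m → vsum v ≡ K * m →
                    (∀ i i' → v i ≤ suc (v i')) → ∀ i → v i ≡ m
balanced-constant {K} v m sum≡ close i with <-cmp (v i) m
... | tri≈ _ v≡m _ = v≡m
... | tri< v<m _ _ = ⊥-elim (<-irrefl sum≡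
      (subst (vsum v <_) (vsum-const K m) (vsum-mono-< v (λ _ → m) (λ i' → ≤-trans (close i' i) v<m) i v<m)))
... | tri> _ _ v>m = ⊥-elim (<-irrefl (sym sum≡)
      (subst (_< vsum v) (vsum-const K m)
             (vsum-mono-< (λ _ → m) v (λ i' → s≤s⁻¹ (≤-trans v>m (close i i'))) i v>m)))

least-unique : ∀ {P : ℕ → Set} {x y} → IsLeast P x → IsLeast P y → x ≡ y
least-unique (Px , x-least) (Py , y-least) = ≤-antisym (x-least _ Py) (y-least _ Px)

positive : ∀ {n e} → Valid n e → 0 < e
positive val = ≤-<-trans z≤n (proj₁ val)

-- The Turán upper bound makes every s with e ≤ t_s(n) satisfy 2e/n² ≤ 1 - 1/s, so
-- k(2e/n²) ≤ k(n,e).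
kλ≤kne : ∀ {n e k} → Valid n e → IsLeast (KλPred n e) k → ∀ s → KnePred n e s → k ≤ s
kλ≤kne {n} {e} val kλ zero e≤0 = ⊥-elim (<⇒≱ (positive {n} {e} val) e≤0)
kλ≤kne {n} {e} val kλ (suc s') e≤t =
  proj₂ kλ (suc s') (s≤s z≤n , ≤-trans (*-monoˡ-≤ (suc s') (*-monoʳ-≤ 2 e≤t)) (turan-upper s' n))

not-kλ-one : ∀ {n e} → Valid n e → ¬ KλPred n e 1
not-kλ-one {n} {e} val (_ , twice-e≤0) =
  <⇒≱ (positive {n} {e} val) (≤-trans (m≤m+n e (e + 0)) (subst (_≤ 0) (*-identityʳ (2 * e)) twice-e≤0))

kλ-strict : ∀ {n e} j → IsLeast (KλPred n e) (suc (suc j)) → j * (n * n) < 2 * e * suc j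
kλ-strict {n} {e} j (_ , least) with 2 * e * suc j ≤? j * (n * n)
... | yes admissible = ⊥-elim (n≮n _ (least (suc j) (s≤s z≤n , admissible)))
... | no inadmissible = ≰⇒> inadmissible

-- With d = k·m - n the defining equation reads K·d² + 2ke = K·n²; as 2e·K > j·n²
-- this forces (K·d)² < n², i.e. K·d < n.
slack-bound : ∀ j n e d → j * (n * n) < 2 * e * suc j →
              suc j * (d * d) + 2 * suc (suc j) * e ≡ suc j * (n * n) → suc j * d < n
slack-bound j n e d strict defining with n ≤? suc j * d
... | no n≰Kd = ≰⇒> n≰Kd
... | yes n≤Kd = ⊥-elim (<⇒≱ (Kd²<n²) (subst (n * n ≤_) (square K d) (*-mono-≤ n≤Kd n≤Kd)))
  where
  K = suc j
  k = suc K
  Z = K * (K * (d * d))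
  scale : ∀ j d e → suc j * (suc j * (d * d)) + suc (suc j) * (2 * e * suc j)
                    ≡ suc j * (suc j * (d * d) + 2 * suc (suc j) * e)
  scale = solve-∀
  split : ∀ j x → suc j * (suc j * x) ≡ suc (suc j) * (j * x) + x
  split = solve-∀
  square : ∀ x d → (x * d) * (x * d) ≡ x * (x * (d * d))
  square = solve-∀
  balance : Z + k * (2 * e * K) ≡ k * (j * (n * n)) + n * n
  balance = trans (scale j d e) (trans (cong (K *_) defining) (split j (n * n)))
  Kd²<n² : Z < n * n
  Kd²<n² = +-cancelˡ-< (k * (j * (n * n))) Z (n * n)
    (subst (_< k * (j * (n * n)) + n * n) (+-comm Z _)
      (subst (Z + k * (j * (n * n)) <_) balance (+-monoʳ-< Z (*-monoʳ-< k strict))))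

edge-count : ∀ j e a d →
  suc j * (d * d) + 2 * suc (suc j) * e ≡ suc j * ((suc j * (a + d) + a) * (suc j * (a + d) + a)) →
  2 * e ≡ suc j * (a + d) * (j * (a + d) + 2 * a)
edge-count j e a d defining = *-cancelˡ-≡ (2 * e) _ k (trans (reorder k e) twice)
  where
  k = suc (suc j)
  reorder : ∀ k e → k * (2 * e) ≡ 2 * k * e
  reorder = solve-∀
  expand : ∀ j a d → suc j * (d * d) + suc (suc j) * (suc j * (a + d) * (j * (a + d) + 2 * a))
                     ≡ suc j * ((suc j * (a + d) + a) * (suc j * (a + d) + a))
  expand = solve-∀
  twice : 2 * k * e ≡ k * (suc j * (a + d) * (j * (a + d) + 2 * a))
  twice = +-cancelˡ-≡ (suc j * (d * d)) _ _ (trans defining (sym (expand j a d)))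

extremal-form : ∀ j n e m → j * (n * n) < 2 * e * suc j → CnEq n e (suc (suc j)) m →
  Σ ℕ λ a → a ≤ m × n ≡ suc j * m + a × 2 * e ≡ suc j * m * (j * m + 2 * a)
extremal-form j n e m strict (n≤km , defining) =
  a , m∸n≤m m d , n≡ , subst (λ x → 2 * e ≡ suc j * x * (j * x + 2 * a)) (sym m≡)
                         (edge-count j e a d (subst (λ x → K * (d * d) + 2 * k * e ≡ K * (x * x)) n≡' defining))
  where
  K = suc j
  k = suc K
  d = k * m ∸ n
  n+d : n + d ≡ k * m
  n+d = m+[n∸m]≡n n≤km
  d<m : d < m
  d<m = *-cancelˡ-< k d m (subst (d + K * d <_) (trans (+-comm d n) n+d)
                                 (+-monoʳ-< d (slack-bound j n e d strict defining)))
  a = m ∸ d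
  m≡ : m ≡ a + d
  m≡ = sym (m∸n+n≡m (<⇒≤ d<m))
  n≡ : n ≡ K * m + a
  n≡ = +-cancelʳ-≡ d n (K * m + a)
    (trans n+d (trans (+-comm m (K * m)) (trans (cong (K * m +_) m≡) (sym (+-assoc (K * m) a d)))))
  n≡' : n ≡ K * (a + d) + a
  n≡' = trans n≡ (cong (λ x → K * x + a) m≡)

extremal-edges : ∀ j m a e → 2 * e ≡ suc j * m * (j * m + 2 * a) →
  2 * e ≡ (suc j * m + a) * (suc j * m + a) ∸ (suc j * (m * m) + a * a)
extremal-edges j m a e edges≡ = trans edges≡ (sym (trans (cong (_∸ P) (sym (expand j a m))) (m+n∸n≡m _ P)))
  where
  P = suc j * (m * m) + a * a
  expand : ∀ j a m → suc j * m * (j * m + 2 * a) + (suc j * (m * m) + a * a)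
                     ≡ (suc j * m + a) * (suc j * m + a)
  expand = solve-∀

extremal-kne : ∀ j m a e → Valid (suc j * m + a) e → IsLeast (KλPred (suc j * m + a) e) (suc (suc j)) →
  2 * e ≡ suc j * m * (j * m + 2 * a) → IsLeast (KnePred (suc j * m + a) e) (suc (suc j))
extremal-kne j m a e val kλ edges≡ =
  *-cancelˡ-≤ 2 (subst (_≤ 2 * turan (suc (suc j)) (suc j * m + a)) (sym (extremal-edges j m a e edges≡))
                       (turan-lower (suc j) m a))
  , kλ≤kne val kλ

extremal-ak-admissible : ∀ j m a e → 2 * e ≡ suc j * m * (j * m + 2 * a) →
  AkPred (suc j * m + a) e (suc (suc j)) a
extremal-ak-admissible j m a e edges≡ =
  subst (λ x → e ≤ a * x + turan K x) (sym (m+n∸n≡m (K * m) a)) (*-cancelˡ-≤ 2 (begin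
    2 * e                                   ≡⟨ trans edges≡ (regroup j a m) ⟩
    2 * (a * (K * m)) + K * j * (m * m)     ≤⟨ +-monoʳ-≤ (2 * (a * (K * m))) (turan-equipartite j m) ⟩
    2 * (a * (K * m)) + 2 * T               ≡⟨ *-distribˡ-+ 2 (a * (K * m)) T ⟨
    2 * (a * (K * m) + T) ∎))
  where
  open ≤-Reasoning
  K = suc j
  T = turan K (K * m)
  regroup : ∀ j a m → suc j * m * (j * m + 2 * a) ≡ 2 * (a * (suc j * m)) + suc j * j * (m * m)
  regroup = solve-∀

-- No x < a is admissible.  Writing a = x + 1 + t and m = a + d, the Turán upper bound gives
-- 2K·(x(n-x) + t_K(n-x)) ≤ 2Kx(n-x) + j(n-x)², which falls short of 2K·e by
-- k(t+1)² + 2K(t+1)d > 0.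
below-a-inadmissible : ∀ j x t d e → 2 * e ≡ suc j * (suc x + t + d) * (j * (suc x + t + d) + 2 * (suc x + t)) →
  ¬ AkPred (suc j * (suc x + t + d) + (suc x + t)) e (suc (suc j)) x
below-a-inadmissible j x t d e edges≡ admissible =
  ≤⇒≯ bound (subst (B <_) deficit (m<m+n B (s≤s z≤n)))
  where
  K = suc j
  N = K * (suc x + t + d) + suc t
  B = 2 * (x * N) * K + j * (N * N)
  shift : ∀ j x t d → suc j * (suc x + t + d) + (suc x + t) ≡ (suc j * (suc x + t + d) + suc t) + x
  shift = solve-∀
  n∸x : suc j * (suc x + t + d) + (suc x + t) ∸ x ≡ N
  n∸x = trans (cong (_∸ x) (shift j x t d)) (m+n∸n≡m N x)
  admissible' : e ≤ x * N + turan K N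
  admissible' = subst (λ y → e ≤ x * y + turan K y) n∸x admissible
  distribute : ∀ y z k → 2 * (y + z) * k ≡ 2 * y * k + 2 * z * k
  distribute = solve-∀
  bound : 2 * e * K ≤ B
  bound = ≤-trans (*-monoˡ-≤ K (*-monoʳ-≤ 2 admissible'))
            (subst (_≤ B) (sym (distribute (x * N) (turan K N) K))
                   (+-monoʳ-≤ (2 * (x * N) * K) (turan-upper j N)))
  gap : ∀ j x t d →
    2 * (x * (suc j * (suc x + t + d) + suc t)) * suc j
      + j * ((suc j * (suc x + t + d) + suc t) * (suc j * (suc x + t + d) + suc t))
      + (suc (suc j) * suc t * suc t + 2 * suc j * suc t * d)
    ≡ suc j * (suc x + t + d) * (j * (suc x + t + d) + 2 * (suc x + t)) * suc j
  gap = solve-∀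
  deficit : B + (suc K * suc t * suc t + 2 * K * suc t * d) ≡ 2 * e * K
  deficit = trans (gap j x t d) (cong (_* K) (sym edges≡))

extremal-ak : ∀ j m a e → a ≤ m → 2 * e ≡ suc j * m * (j * m + 2 * a) →
  IsLeast (AkPred (suc j * m + a) e (suc (suc j))) a
extremal-ak j m a e a≤m edges≡ = extremal-ak-admissible j m a e edges≡ , minimal
  where
  minimal : ∀ x → AkPred (suc j * m + a) e (suc (suc j)) x → a ≤ x
  minimal x admissible with a ≤? x
  ... | yes a≤x = a≤x
  ... | no a≰x with m ∸ a | m+[n∸m]≡n a≤m | a ∸ suc x | m+[n∸m]≡n (≰⇒> a≰x)
  ...   | d | refl | t | refl = ⊥-elim (below-a-inadmissible j x t d e edges≡ admissible)

lemma4p14 : ∀ (n e : ℕ) → Valid n e →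
    ∀ (k : ℕ) → IsLeast (KλPred n e) k →
    ∀ (m : ℕ) → CnEq n e k m →
    IsLeast (KnePred n e) k ×
    (∀ (ak : ℕ) → IsLeast (AkPred n e k) ak →
     ∀ (v : Vector ℕ (k ∸ 1)) → Balanced v (n ∸ ak) →
     (∀ (i : Fin (k ∸ 1)) → v i ≡ m) × (ak ≡ n ∸ (k ∸ 1) * m))
lemma4p14 n e val zero          ((() , _) , _) m cn
lemma4p14 n e val (suc zero)    (kλ-one , _)   m cn = ⊥-elim (not-kλ-one {n} {e} val kλ-one)
lemma4p14 n e val (suc (suc j)) kλ m cn with extremal-form j n e m (kλ-strict {n} {e} j kλ) cn
... | a , a≤m , refl , edges≡ = extremal-kne j m a e val kλ edges≡ , a*-shape
  where
  K = suc j
  a*-shape : ∀ ak → IsLeast (AkPred (K * m + a) e (suc K)) ak →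
             ∀ (v : Vector ℕ K) → Balanced v (K * m + a ∸ ak) →
             (∀ i → v i ≡ m) × (ak ≡ K * m + a ∸ K * m)
  a*-shape ak ak-least v (sum≡ , _ , close) =
    balanced-constant v m (trans sum≡ (trans (cong (K * m + a ∸_) ak≡a) (m+n∸n≡m (K * m) a))) close
    , trans ak≡a (sym (m+n∸m≡n (K * m) a))
    where
    ak≡a : ak ≡ a
    ak≡a = least-unique ak-least (extremal-ak j m a e a≤m edges≡)
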